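{- Let $B\subseteq\mathbb{N}$ be a set such that neither $B$ nor $\mathbb{N}\setminus B$ is negligible. Then there exists a uniform total function $f\colon\mathbb{N}\to\mathbb{N}$ that reduces the set of even numbers to $B$, i.e., $f(x)\in B$ for every even $x$ and $f(x)\notin B$ for every odd $x$.
   Context: For $A\subseteq \mathbb{N}$ and $n\ge 1$, $\rho_n(A) = \#\{k<n \mid k\in A\}/n$. A set $A$ is negligible if $\lim_n \rho_n(A)=0$. A total function $f\colon\mathbb{N}\to\mathbb{N}$ is uniform if $f^{ -1}(S)$ is negligible for every negligible $S\subseteq\mathbb{N}$. -}

module Defs where

open import Data.Bool using (Bool; true; false; not; if_then_else_)
open import Data.Nat using (ℕ; zero; suc; _+_; _*_; _≤_; _<_)
open import Data.Product using (Σ; ∃; _×_)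

Subset : Set
Subset = ℕ → Bool

-- count A n = #{ k < n | k ∈ A }   (so ρ_n(A) = count A n / n)
count : Subset → ℕ → ℕ
count A zero    = 0
count A (suc n) = count A n + (if A n then 1 else 0)

∁ : Subset → Subset
∁ A x = not (A x)

-- A is negligible: lim ρ_n(A) = 0, i.e. for every k there is N with
-- ρ_n(A) ≤ 1/k (i.e. k * count A n ≤ n) for all n ≥ N.
Negligible : Subset → Set
Negligible A = ∀ (k : ℕ) → ∃ λ (N : ℕ) → ∀ (n : ℕ) → N ≤ n → k * count A n ≤ n

-- A is not negligible: the (classical) negation of Negligible written out,
-- i.e. there is k such that ρ_n(A) > 1/k for infinitely many n.
NonNegligible : Subset → Set
NonNegligible A = ∃ λ (k : ℕ) → ∀ (N : ℕ) → ∃ λ (n : ℕ) → N ≤ n × n < k * count A n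

Uniform : (ℕ → ℕ) → Set
Uniform f = ∀ (S : Subset) → Negligible S → Negligible (λ x → S (f x))

module Submission where

-- It suffices to show that every non-negligible set A is
-- the range of some uniform g : ℕ → ℕ.  Taking such g for B and for ∁ B, the
-- function f sending even x to g_B x and odd x to g_∁B x reduces the even
-- numbers to B, and f is uniform because a pointwise choice between two uniform
-- functions is uniform (negligible sets are closed under finite unions).
--
-- To build g for A, fix k such that infinitely many m are *dense*, i.e.
-- m < k · #(A ∩ [0,m)).  The function g runs through consecutive blocks: a
-- block started at time s enumerates A ∩ [0,m) for the latest dense point m
-- up to s, so m ≤ s + d₀ with d₀ the first dense point.  Given a negligible S
-- and a factor K, eventually K · #(S ∩ [0,m)) ≤ m < k · (length of the block),
-- so every late complete block spends at most a fraction k/K of its length in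
-- g⁻¹(S); the running block contributes at most (x + d₀)/K, and blocks with a
-- small dense point only occur before a fixed time.  Hence for every K there
-- is E with K · #(g⁻¹(S) ∩ [0,x)) ≤ E + (k+1)·x, which makes g⁻¹(S) negligible.

open import Defs
open import Data.Bool using (Bool; true; false; if_then_else_; _∧_; T)
open import Data.Bool.Properties using (not-injective; T-≡)
open import Data.Empty using (⊥-elim)
open import Data.Nat
open import Data.Nat.Properties
open import Algebra.Properties.CommutativeSemigroup +-commutativeSemigroup
  using (interchange)
open import Data.Nat.Divisibility using (_∣_; _∣?_)
open import Data.Nat.Solver using (module +-*-Solver)
open import Data.Product using (∃; _×_; _,_; proj₁; proj₂)
open import Data.Sum using (inj₁; inj₂)
open import Function using (_∘_)
open import Function.Bundles using (Equivalence)
open import Relation.Binary.PropositionalEquality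
open import Relation.Nullary using (¬_; yes; no)
open import Relation.Nullary.Decidable using (⌊_⌋)

bit : Bool → ℕ
bit b = if b then 1 else 0

bit≤1 : ∀ b → bit b ≤ 1
bit≤1 true  = ≤-refl
bit≤1 false = z≤n

count≤ : ∀ P n → count P n ≤ n
count≤ P zero    = z≤n
count≤ P (suc n) =
  subst (count P n + bit (P n) ≤_) (+-comm n 1) (+-mono-≤ (count≤ P n) (bit≤1 (P n)))

count-mono : ∀ P {m n} → m ≤ n → count P m ≤ count P n
count-mono P {n = zero}  z≤n = ≤-refl
count-mono P {n = suc n} m≤1+n with m≤n⇒m<n∨m≡n m≤1+n
... | inj₂ refl        = ≤-refl
... | inj₁ (s≤s m≤n)   = ≤-trans (count-mono P m≤n) (m≤m+n _ _)

count-cong : ∀ P Q n → (∀ t → t < n → P t ≡ Q t) → count P n ≡ count Q n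
count-cong P Q zero    _   = refl
count-cong P Q (suc n) P≡Q =
  cong₂ _+_ (count-cong P Q n (λ t t<n → P≡Q t (m≤n⇒m≤1+n t<n))) (cong bit (P≡Q n ≤-refl))

count-subadditive : ∀ P Q R n → (∀ t → bit (P t) ≤ bit (Q t) + bit (R t)) →
  count P n ≤ count Q n + count R n
count-subadditive P Q R zero    _ = z≤n
count-subadditive P Q R (suc n) P⊆Q∪R = begin
  count P n + bit (P n)
    ≤⟨ +-mono-≤ (count-subadditive P Q R n P⊆Q∪R) (P⊆Q∪R n) ⟩
  (count Q n + count R n) + (bit (Q n) + bit (R n))
    ≡⟨ interchange (count Q n) (count R n) (bit (Q n)) (bit (R n)) ⟩
  count Q (suc n) + count R (suc n) ∎
  where open ≤-Reasoning

negligible-cover : ∀ P Q R → Negligible Q → Negligible R →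
  (∀ n → count P n ≤ count Q n + count R n) → Negligible P
negligible-cover P Q R negQ negR P⊆Q∪R k = NQ ⊔ NR , λ n N≤n → *-cancelˡ-≤ 2 (begin
  2 * (k * count P n)                         ≤⟨ *-monoʳ-≤ 2 (*-monoʳ-≤ k (P⊆Q∪R n)) ⟩
  2 * (k * (count Q n + count R n))           ≡⟨ distribute k (count Q n) (count R n) ⟩
  2 * k * count Q n + 2 * k * count R n
    ≤⟨ +-mono-≤ (proj₂ (negQ (2 * k)) n (≤-trans (m≤m⊔n NQ NR) N≤n))
                (proj₂ (negR (2 * k)) n (≤-trans (m≤n⊔m NQ NR) N≤n)) ⟩
  n + n                                       ≡⟨ cong (n +_) (sym (+-identityʳ n)) ⟩
  2 * n                                       ∎)
  where
    open ≤-Reasoning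
    open +-*-Solver
    NQ NR : ℕ
    NQ = proj₁ (negQ (2 * k))
    NR = proj₁ (negR (2 * k))
    distribute : ∀ k a b → 2 * (k * (a + b)) ≡ 2 * k * a + 2 * k * b
    distribute = solve 3 (λ k a b → con 2 :* (k :* (a :+ b))
                                 := con 2 :* k :* a :+ con 2 :* k :* b) refl

negligible-by-linear-bound : ∀ P c →
  (∀ K → ∃ λ E → ∀ n → K * count P n ≤ E + c * n) → Negligible P
negligible-by-linear-bound P c bound k = E , λ n E≤n → *-cancelˡ-≤ (suc c) (begin
  suc c * (k * count P n) ≡⟨ sym (*-assoc (suc c) k (count P n)) ⟩
  suc c * k * count P n   ≤⟨ proj₂ (bound (suc c * k)) n ⟩
  E + c * n               ≤⟨ +-monoˡ-≤ (c * n) E≤n ⟩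
  suc c * n               ∎)
  where
    open ≤-Reasoning
    E : ℕ
    E = proj₁ (bound (suc c * k))

module Enumeration (A : Subset) where

  -- nth m t is the t-th element of A ∩ [0,m), counting from 0, when t < #(A ∩ [0,m)).
  nth : ℕ → ℕ → ℕ
  nth zero    t = 0
  nth (suc m) t = if A m ∧ (t ≡ᵇ count A m) then m else nth m t

  nth-∈ : ∀ m t → t < count A m → A (nth m t) ≡ true
  nth-∈ (suc m) t t<c with A m in Am
  ... | false = nth-∈ m t (subst (t <_) (+-identityʳ _) t<c)
  ... | true with t ≡ᵇ count A m in t≟c
  ...   | true  = Am
  ...   | false = nth-∈ m t (≤∧≢⇒< (m<1+n⇒m≤n (subst (t <_) (+-comm _ 1) t<c))
                                   (λ t≡c → subst T t≟c (≡⇒≡ᵇ t _ t≡c)))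

  -- The enumeration is injective into [0,m), so it meets any S at most
  -- #(S ∩ [0,m)) times.
  nth-hits : ∀ S m → count (S ∘ nth m) (count A m) ≤ count S m
  nth-hits S zero = z≤n
  nth-hits S (suc m) with A m in Am
  ... | false = begin
    count (S ∘ nth m) (count A m + 0) ≡⟨ cong (count (S ∘ nth m)) (+-identityʳ (count A m)) ⟩
    count (S ∘ nth m) (count A m)     ≤⟨ nth-hits S m ⟩
    count S m                         ≤⟨ m≤m+n _ _ ⟩
    count S m + bit (S m)             ∎
    where open ≤-Reasoning
  ... | true = begin
    count (S ∘ nth′) (c + 1)               ≡⟨ cong (count (S ∘ nth′)) (+-comm c 1) ⟩
    count (S ∘ nth′) c + bit (S (nth′ c))  ≡⟨ cong₂ _+_ (count-cong _ _ c (λ t → cong S ∘ nth′-below t))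
                                                         (cong (bit ∘ S) nth′-top) ⟩
    count (S ∘ nth m) c + bit (S m)        ≤⟨ +-monoˡ-≤ _ (nth-hits S m) ⟩
    count S m + bit (S m)                  ∎
    where
      open ≤-Reasoning
      c : ℕ
      c = count A m
      -- the enumeration of A ∩ [0, m+1) when m ∈ A
      nth′ : ℕ → ℕ
      nth′ t = if t ≡ᵇ c then m else nth m t
      nth′-top : nth′ c ≡ m
      nth′-top rewrite Equivalence.to T-≡ (≡⇒≡ᵇ c c refl) = refl
      nth′-below : ∀ t → t < c → nth′ t ≡ nth m t
      nth′-below t t<c with t ≡ᵇ c in t≟c
      ... | false = refl
      ... | true  = ⊥-elim (<⇒≢ t<c (≡ᵇ⇒≡ t c (Equivalence.from T-≡ t≟c)))

module BlockEnumeration (A : Subset) (k : ℕ)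
  (dense-unbounded : ∀ N → ∃ λ m → N ≤ m × m < k * count A m) where

  open Enumeration A

  dense : ℕ → Bool
  dense m = m <ᵇ k * count A m

  dense⇒ : ∀ {m} → dense m ≡ true → m < k * count A m
  dense⇒ {m} d = <ᵇ⇒< m (k * count A m) (Equivalence.from T-≡ d)

  ⇒dense : ∀ {m} → m < k * count A m → dense m ≡ true
  ⇒dense m<kc = Equivalence.to T-≡ (<⇒<ᵇ m<kc)

  dense⇒nonempty : ∀ {m} → dense m ≡ true → 0 < count A m
  dense⇒nonempty {m} d with count A m | dense⇒ d
  ... | zero  | m<k*0 = ⊥-elim (n≮0 (subst (m <_) (*-zeroʳ k) m<k*0))
  ... | suc _ | _     = z<s

  d₀ : ℕ
  d₀ = proj₁ (dense-unbounded 0)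

  -- latest y is the largest dense point in [1,y], or d₀ if there is none.
  latest : ℕ → ℕ
  latest zero    = d₀
  latest (suc y) = if dense (suc y) then suc y else latest y

  latest-dense : ∀ y → dense (latest y) ≡ true
  latest-dense zero = ⇒dense (proj₂ (proj₂ (dense-unbounded 0)))
  latest-dense (suc y) with dense (suc y) in d
  ... | true  = d
  ... | false = latest-dense y

  latest-≤ : ∀ y → latest y ≤ y + d₀
  latest-≤ zero = ≤-refl
  latest-≤ (suc y) with dense (suc y)
  ... | true  = m≤m+n (suc y) d₀
  ... | false = m≤n⇒m≤1+n (latest-≤ y)

  latest-≥ : ∀ {X} y → dense X ≡ true → X ≤ y → X ≤ latest y
  latest-≥ zero    _ z≤n = z≤n
  latest-≥ (suc y) dX X≤1+y with dense (suc y) in d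
  ... | true  = X≤1+y
  ... | false with m≤n⇒m<n∨m≡n X≤1+y
  ...   | inj₁ (s≤s X≤y) = latest-≥ y dX X≤y
  ...   | inj₂ refl      = ⊥-elim (subst T d (Equivalence.from T-≡ dX))

  -- The state at time x is a dense point (block x) and a position (pos x) in
  -- the enumeration of A ∩ [0, block x).  After the last position a new block
  -- starts, for the latest dense point up to the current time.
  step : ℕ → ℕ × ℕ → ℕ × ℕ
  step x s = if suc (proj₂ s) <ᵇ count A (proj₁ s)
             then (proj₁ s , suc (proj₂ s))
             else (latest (suc x) , 0)

  state : ℕ → ℕ × ℕ
  state zero    = (d₀ , 0)
  state (suc x) = step x (state x)

  block pos block-start : ℕ → ℕ
  block x = proj₁ (state x)
  pos   x = proj₂ (state x)
  block-start x = x ∸ pos x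

  g : ℕ → ℕ
  g x = nth (block x) (pos x)

  -- The invariant of a state s = (m , t) at time x: the block is nonempty,
  -- began at time x ∸ t, and belongs to the latest dense point up to then.
  record Invariant (x : ℕ) (s : ℕ × ℕ) : Set where
    field
      pos<size     : proj₂ s < count A (proj₁ s)
      pos≤time     : proj₂ s ≤ x
      block≡latest : proj₁ s ≡ latest (x ∸ proj₂ s)

  invariant : ∀ x → Invariant x (state x)
  invariant zero = record
    { pos<size = dense⇒nonempty (latest-dense 0) ; pos≤time = z≤n ; block≡latest = refl }
  invariant (suc x) with suc (pos x) <ᵇ count A (block x) in more
  ... | true  = record
    { pos<size     = <ᵇ⇒< _ _ (Equivalence.from T-≡ more)
    ; pos≤time     = s≤s (Invariant.pos≤time (invariant x))
    ; block≡latest = Invariant.block≡latest (invariant x) }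
  ... | false = record
    { pos<size = dense⇒nonempty (latest-dense (suc x)) ; pos≤time = z≤n ; block≡latest = refl }

  block-dense : ∀ x → dense (block x) ≡ true
  block-dense x = subst (λ m → dense m ≡ true) (sym (Invariant.block≡latest (invariant x)))
                        (latest-dense (block-start x))

  g-∈ : ∀ x → A (g x) ≡ true
  g-∈ x = nth-∈ (block x) (pos x) (Invariant.pos<size (invariant x))

  block-start+length : ∀ x → block-start x + suc (pos x) ≡ suc x
  block-start+length x = trans (+-suc (block-start x) (pos x))
                         (cong suc (m∸n+n≡m (Invariant.pos≤time (invariant x))))

  module Hits (S : Subset) (K N : ℕ) (S-sparse : ∀ m → N ≤ m → K * count S m ≤ m)
              (X : ℕ) (N≤X : N ≤ X) (X-dense : dense X ≡ true) where

    hits : ℕ → ℕ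
    hits = count (S ∘ g)

    block-hits : ℕ → ℕ
    block-hits x = count (S ∘ nth (block x)) (pos x)

    -- Blocks of dense points below N only occur before time X + N, since from
    -- time X on the latest dense point is at least X.
    early-block : ∀ x → block x < N → suc x ≤ X + N
    early-block x m<N = begin
      suc x                       ≡⟨ sym (block-start+length x) ⟩
      block-start x + suc (pos x) ≤⟨ +-mono-≤ block-start≤X size≤N ⟩
      X + N                       ∎
      where
        open ≤-Reasoning
        open Invariant (invariant x)
        size≤N : suc (pos x) ≤ N
        size≤N = ≤-trans pos<size (≤-trans (count≤ A (block x)) (<⇒≤ m<N))
        block-start≤X : block-start x ≤ X
        block-start≤X with X ≤? block-start x
        ... | no  X≰s = <⇒≤ (≰⇒> X≰s)
        ... | yes X≤s = ⊥-elim (<⇒≱ m<N (≤-trans N≤X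
                          (subst (X ≤_) (sym block≡latest) (latest-≥ (block-start x) X-dense X≤s))))

    complete-block : ∀ m → N ≤ m → dense m ≡ true →
      K * count (S ∘ nth m) (count A m) ≤ k * count A m
    complete-block m N≤m m-dense = begin
      K * count (S ∘ nth m) (count A m) ≤⟨ *-monoʳ-≤ K (nth-hits S m) ⟩
      K * count S m                     ≤⟨ S-sparse m N≤m ⟩
      m                                 ≤⟨ <⇒≤ (dense⇒ m-dense) ⟩
      k * count A m                     ∎
      where open ≤-Reasoning

    add-hit : ∀ h b R q → K * h ≤ R + K * q → K * (h + b) ≤ R + K * (q + b)
    add-hit h b R q le = begin
      K * (h + b)         ≡⟨ *-distribˡ-+ K h b ⟩
      K * h + K * b       ≤⟨ +-monoˡ-≤ (K * b) le ⟩
      R + K * q + K * b   ≡⟨ +-assoc R _ _ ⟩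
      R + (K * q + K * b) ≡⟨ cong (R +_) (sym (*-distribˡ-+ K q b)) ⟩
      R + K * (q + b)     ∎
      where open ≤-Reasoning

    -- Completed blocks contribute at most k/K of their length, early blocks at
    -- most X + N in total.
    hits-bound : ∀ x → K * hits x ≤ K * (X + N) + k * block-start x + K * block-hits x
    hits-bound zero rewrite *-zeroʳ K = z≤n
    hits-bound (suc x) with suc (pos x) <ᵇ count A (block x) in more
    ... | true = add-hit (hits x) _ _ (block-hits x) (hits-bound x)
    ... | false with N ≤? block x
    ...   | no N≰m = ≤-trans (*-monoʳ-≤ K (≤-trans (count≤ _ (suc x)) (early-block x (≰⇒> N≰m))))
                             (≤-trans (m≤m+n _ _) (m≤m+n _ _))
    ...   | yes N≤m = begin
      K * (hits x + bit (S (g x)))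
        ≤⟨ add-hit (hits x) _ _ (block-hits x) (hits-bound x) ⟩
      C + k * block-start x + K * count (S ∘ nth m) (suc t)
        ≡⟨ cong (λ c → C + k * block-start x + K * count (S ∘ nth m) c) complete ⟩
      C + k * block-start x + K * count (S ∘ nth m) (count A m)
        ≤⟨ +-monoʳ-≤ _ (complete-block m N≤m (block-dense x)) ⟩
      C + k * block-start x + k * count A m
        ≡⟨ cong (λ c → C + k * block-start x + k * c) (sym complete) ⟩
      C + k * block-start x + k * suc t
        ≡⟨ +-assoc C _ _ ⟩
      C + (k * block-start x + k * suc t)
        ≡⟨ cong (C +_) (sym (*-distribˡ-+ k (block-start x) (suc t))) ⟩
      C + k * (block-start x + suc t)
        ≡⟨ cong (λ y → C + k * y) (block-start+length x) ⟩
      C + k * suc x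
        ≡⟨ sym (+-identityʳ _) ⟩
      C + k * suc x + 0
        ≡⟨ cong (C + k * suc x +_) (sym (*-zeroʳ K)) ⟩
      C + k * suc x + K * 0
        ∎
      where
        open ≤-Reasoning
        C m t : ℕ
        C = K * (X + N)
        m = block x
        t = pos x
        complete : suc t ≡ count A m
        complete = ≤-antisym (Invariant.pos<size (invariant x))
                             (≮⇒≥ (λ lt → subst T more (<⇒<ᵇ lt)))

    running-block : ∀ x → K * block-hits x ≤ x + d₀ + K * N
    running-block x with N ≤? block x
    ... | yes N≤m = begin
      K * block-hits x       ≤⟨ *-monoʳ-≤ K (≤-trans (count-mono _ (<⇒≤ pos<size))
                                                    (nth-hits S (block x))) ⟩
      K * count S (block x)  ≤⟨ S-sparse (block x) N≤m ⟩
      block x                ≡⟨ block≡latest ⟩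
      latest (block-start x) ≤⟨ latest-≤ (block-start x) ⟩
      block-start x + d₀     ≤⟨ +-monoˡ-≤ d₀ (m∸n≤m x (pos x)) ⟩
      x + d₀                 ≤⟨ m≤m+n _ _ ⟩
      x + d₀ + K * N         ∎
      where
        open ≤-Reasoning
        open Invariant (invariant x)
    ... | no N≰m = ≤-trans (*-monoʳ-≤ K block-hits≤N) (m≤n+m _ _)
      where
        open Invariant (invariant x)
        block-hits≤N : block-hits x ≤ N
        block-hits≤N = ≤-trans (count≤ _ (pos x))
          (≤-trans (<⇒≤ pos<size) (≤-trans (count≤ A (block x)) (<⇒≤ (≰⇒> N≰m))))

    E : ℕ
    E = K * (X + N) + d₀ + K * N

    hits-linear : ∀ x → K * hits x ≤ E + suc k * x
    hits-linear x = begin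
      K * hits x
        ≤⟨ hits-bound x ⟩
      K * (X + N) + k * block-start x + K * block-hits x
        ≤⟨ +-mono-≤ (+-monoʳ-≤ (K * (X + N)) (*-monoʳ-≤ k (m∸n≤m x (pos x)))) (running-block x) ⟩
      K * (X + N) + k * x + (x + d₀ + K * N)
        ≡⟨ rearrange (K * (X + N)) (k * x) x d₀ (K * N) ⟩
      E + (x + k * x)
        ∎
      where
        open ≤-Reasoning
        open +-*-Solver
        rearrange : ∀ a b c d e → a + b + (c + d + e) ≡ a + d + e + (c + b)
        rearrange = solve 5 (λ a b c d e → a :+ b :+ (c :+ d :+ e)
                                        := a :+ d :+ e :+ (c :+ b)) refl

  g-uniform : Uniform g
  g-uniform S S-negligible = negligible-by-linear-bound (S ∘ g) (suc k) λ K →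
    let (N , S-sparse)      = S-negligible K
        (X , N≤X , X-dense) = dense-unbounded N
        open Hits S K N S-sparse X N≤X (⇒dense X-dense)
    in E , hits-linear

uniform-choice : ∀ (P : ℕ → Bool) g h → Uniform g → Uniform h →
  Uniform (λ x → if P x then g x else h x)
uniform-choice P g h g-uniform h-uniform S S-negligible =
  negligible-cover _ (S ∘ g) (S ∘ h) (g-uniform S S-negligible) (h-uniform S S-negligible)
    (λ n → count-subadditive _ (S ∘ g) (S ∘ h) n covered)
  where
    covered : ∀ x → bit (S (if P x then g x else h x)) ≤ bit (S (g x)) + bit (S (h x))
    covered x with P x
    ... | true  = m≤m+n _ _
    ... | false = m≤n+m _ _

lemma2 : (B : Subset) → NonNegligible B → NonNegligible (∁ B) →
    ∃ λ (f : ℕ → ℕ) → Uniform f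
    × (∀ (x : ℕ) → 2 ∣ x → B (f x) ≡ true)
    × (∀ (x : ℕ) → ¬ (2 ∣ x) → B (f x) ≡ false)
lemma2 B (k , B-dense) (k′ , ∁B-dense) =
  f , uniform-choice (λ x → ⌊ 2 ∣? x ⌋) In.g Out.g In.g-uniform Out.g-uniform , even , odd
  where
    module In  = BlockEnumeration B k B-dense
    module Out = BlockEnumeration (∁ B) k′ ∁B-dense
    f : ℕ → ℕ
    f x = if ⌊ 2 ∣? x ⌋ then In.g x else Out.g x
    even : ∀ x → 2 ∣ x → B (f x) ≡ true
    even x 2∣x with 2 ∣? x
    ... | yes _   = In.g-∈ x
    ... | no  2∤x = ⊥-elim (2∤x 2∣x)
    odd : ∀ x → ¬ (2 ∣ x) → B (f x) ≡ false
    odd x 2∤x with 2 ∣? x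
    ... | yes 2∣x = ⊥-elim (2∤x 2∣x)
    ... | no  _   = not-injective (Out.g-∈ x)
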